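{- Let $q$ be a prime power with $q\equiv 1 \pmod 3$, and let $C_A(q)$ be the contraction graph of $AGL(1,q)$ with respect to a distinguished element $F\in GF(q)$. Let $\pi,\sigma$ be vertices of $C_A(q)$ with $\sigma(x)=ax+r$ and $\pi(x)=bx+s$ ($a,b\neq 0$). (a) If $a\neq b$, then $hd(\pi,\sigma)=q-1$. (b) If $\pi(F)=F$, then $\pi$ is an isolated vertex of $C_A(q)$. There are exactly $q-1$ elements $\pi\in AGL(1,q)$ with $\pi(F)=F$. (c) Suppose $\pi$ and $\sigma$ are adjacent in $C_A(q)$. Then (c1) $hd(\pi,\sigma)=q-1$ and $hd(\pi^{\triangle},\sigma^{\triangle})=hd(\pi,\sigma)-3$; and (c2) $a/b$ and $b/a$ are the two distinct roots in $GF(q)$ of $t^2+t+1=0$.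
   Context: $AGL(1,q)$ is the group of maps $x\mapsto ax+b$ on the finite field $GF(q)$ with $a,b\in GF(q)$, $a\ne0$, under composition. For permutations $\pi,\sigma$, $hd(\pi,\sigma)=|\{x:\pi(x)\neq\sigma(x)\}|$. Fix $F\in GF(q)$. For a permutation $\pi$ of $GF(q)$, $\pi^{\triangle}$ is the permutation with $\pi^{\triangle}(\pi^{ -1}(F))=\pi(F)$, $\pi^{\triangle}(F)=F$, and $\pi^{\triangle}(x)=\pi(x)$ otherwise. The contraction graph $C_A(q)$ has vertex set $AGL(1,q)$, and distinct $\pi,\sigma$ are adjacent iff $hd(\pi^{\triangle},\sigma^{\triangle})=q-4$. -}

module Defs where

open import Level using (Level; suc; _⊔_)
open import Data.Nat using (ℕ; _∸_)
open import Data.Fin using (Fin)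
open import Data.List using (List; length; filter; allFin; cartesianProduct)
open import Data.Product using (Σ; ∃; _×_; _,_; proj₁; proj₂)
open import Relation.Nullary using (¬_; Dec; yes; no)
open import Relation.Nullary.Decidable using (¬?; _×-dec_)
open import Relation.Binary.PropositionalEquality using (_≡_)
open import Algebra.Bundles using (CommutativeRing)

record FiniteField (c ℓ : Level) (q : ℕ) : Set (suc (c ⊔ ℓ)) where
  field
    commRing : CommutativeRing c ℓ
  open CommutativeRing commRing public
  field
    _≟_      : (x y : Carrier) → Dec (x ≈ y)
    0≉1      : ¬ (0# ≈ 1#)
    _⁻¹      : Carrier → Carrier
    inverseʳ : (x : Carrier) → ¬ (x ≈ 0#) → (x * (x ⁻¹)) ≈ 1#
    enum     : Fin q → Carrier
    enum-inj : (i j : Fin q) → enum i ≈ enum j → i ≡ j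
    enum-sur : (x : Carrier) → ∃ λ i → enum i ≈ x

module _ {c ℓ : Level} {q : ℕ} (K : FiniteField c ℓ q) where
  open FiniteField K

  record AGL : Set (c ⊔ ℓ) where
    constructor affine
    field
      coef  : Carrier
      shift : Carrier
      coef≉0 : ¬ (coef ≈ 0#)

  ⟦_⟧ : AGL → Carrier → Carrier
  ⟦ affine a b _ ⟧ x = a * x + b

  _≈AGL_ : AGL → AGL → Set ℓ
  π ≈AGL σ = (AGL.coef π ≈ AGL.coef σ) × (AGL.shift π ≈ AGL.shift σ)

  hd : (Carrier → Carrier) → (Carrier → Carrier) → ℕ
  hd f g = length (filter (λ i → ¬? (f (enum i) ≟ g (enum i))) (allFin q))

  contract : Carrier → (Carrier → Carrier) → Carrier → Carrier
  contract F π x with x ≟ F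
  ... | yes _ = F
  ... | no _ with π x ≟ F
  ...   | yes _ = π F
  ...   | no _ = π x

  Adjacent : Carrier → AGL → AGL → Set ℓ
  Adjacent F π σ = ¬ (π ≈AGL σ) ×
    (hd (contract F ⟦ π ⟧) (contract F ⟦ σ ⟧) ≡ q ∸ 4)

  #fixing : Carrier → ℕ
  #fixing F = length (filter
    (λ p → ¬? (enum (proj₁ p) ≟ 0#) ×-dec ((enum (proj₁ p) * F + enum (proj₂ p)) ≟ F))
    (cartesianProduct (allFin q) (allFin q)))

-- π△ agrees with π except at F and π⁻¹(F), so π△ and σ△ can only agree at F, π⁻¹(F),
-- σ⁻¹(F) and where π and σ agree.  Each of these sets has at most one element (π and σ agree
-- nowhere if their slopes coincide, and at exactly one point otherwise), so adjacency, i.e.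
-- four agreements, makes them four distinct agreement points.  Hence π(F) ≠ F, and the
-- agreements at u = π⁻¹(F) and v = σ⁻¹(F) say π(F) = σ(u) and σ(F) = π(v).  For σ x = a x + r
-- and π x = b x + s these read (a + b)(u − F) = a(v − F) and (b + a)(v − F) = b(u − F), whose
-- product gives (a² + ab + b²)(u − F)(v − F) = 0 with u ≠ F ≠ v.

module Submission where

open import Defs
open import Level using (Level)
open import Data.Nat using (ℕ; _∸_; _%_)
open import Data.Product using (_×_)
open import Relation.Nullary using (¬_)
open import Relation.Binary.PropositionalEquality using (_≡_)
open import Algebra.Bundles using (CommutativeRing)

module Counting where

  open import Level using (Level)
  open import Function using (_∘_)
  open import Data.Nat using (ℕ; zero; suc; _+_; _≤_; z≤n; s≤s)
  open import Data.Nat.Properties using (≤-trans; ≤-reflexive; +-monoʳ-≤; +-suc; n≤1+n)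
  open import Data.Fin using (Fin; zero; suc)
  open import Data.Fin.Properties using (suc-injective; 0≢1+n)
  open import Data.List using (List; []; _∷_; [_]; _++_; length; filter; tabulate; map; cartesianProduct)
  open import Data.List.Properties using (filter-none; filter-some; filter-++; length-++)
  import Data.List.Relation.Unary.All.Properties as All
  import Data.List.Relation.Unary.Any.Properties as Any
  open import Data.List.Relation.Binary.Sublist.Heterogeneous.Properties using (⊆-filter-Sublist; length-mono-≤)
  open import Data.List.Relation.Binary.Sublist.Propositional using (⊆-refl)
  open import Data.Product using (_×_; _,_)
  open import Relation.Nullary using (¬_; yes; no)
  open import Relation.Unary using (Pred; Decidable; _⊆_)
  open import Relation.Unary.Properties using (∁?; _∪?_)
  open import Relation.Binary.PropositionalEquality using (_≡_; refl; cong; cong₂; sym; trans; module ≡-Reasoning)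

  private variable a b p q : Level

  count : {A : Set a} {P : Pred A p} → Decidable P → List A → ℕ
  count P? xs = length (filter P? xs)

  module _ {A : Set a} {P : Pred A p} (P? : Decidable P) where

    count-+-count-∁ : ∀ xs → count P? xs + count (∁? P?) xs ≡ length xs
    count-+-count-∁ [] = refl
    count-+-count-∁ (x ∷ xs) with P? x
    ... | yes _ = cong suc (count-+-count-∁ xs)
    ... | no _  = trans (+-suc _ _) (cong suc (count-+-count-∁ xs))

    count-tabulate≡0 : ∀ {n} (f : Fin n → A) → (∀ i → ¬ P (f i)) → count P? (tabulate f) ≡ 0
    count-tabulate≡0 f none = cong length (filter-none P? (All.tabulate⁺ none))

    count-tabulate≤1 : ∀ {n} (f : Fin n → A) → (∀ i j → P (f i) → P (f j) → i ≡ j) →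
                       count P? (tabulate f) ≤ 1
    count-tabulate≤1 {zero} f unique = z≤n
    count-tabulate≤1 {suc n} f unique with P? (f zero)
    ... | yes p₀ = s≤s (≤-reflexive (count-tabulate≡0 (f ∘ suc) λ i pᵢ → 0≢1+n (unique zero (suc i) p₀ pᵢ)))
    ... | no _   = count-tabulate≤1 (f ∘ suc) λ i j pᵢ pⱼ → suc-injective (unique (suc i) (suc j) pᵢ pⱼ)

    count-tabulate≥1 : ∀ {n} (f : Fin n → A) i → P (f i) → 1 ≤ count P? (tabulate f)
    count-tabulate≥1 f i pi = filter-some P? (Any.tabulate⁺ i pi)

  module _ {A : Set a} {P : Pred A p} {Q : Pred A p} (P? : Decidable P) (Q? : Decidable Q) where

    count-mono : P ⊆ Q → ∀ xs → count P? xs ≤ count Q? xs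
    count-mono P⊆Q xs = length-mono-≤ (⊆-filter-Sublist P? Q? (λ { refl → P⊆Q }) (⊆-refl {x = xs}))

    count-∪ : ∀ xs → count (P? ∪? Q?) xs ≤ count P? xs + count Q? xs
    count-∪ [] = z≤n
    count-∪ (x ∷ xs) with P? x | Q? x
    ... | yes _ | yes _ = s≤s (≤-trans (count-∪ xs) (+-monoʳ-≤ (count P? xs) (n≤1+n _)))
    ... | yes _ | no _  = s≤s (count-∪ xs)
    ... | no _  | yes _ = ≤-trans (s≤s (count-∪ xs)) (≤-reflexive (sym (+-suc _ _)))
    ... | no _  | no _  = count-∪ xs

  module _ {A : Set a} {B : Set b} {P : Pred (A × B) p} {R : Pred A p}
           (P? : Decidable P) (R? : Decidable R) (ys : List B) where

    count-cartesianProduct : (∀ x → count P? (map (x ,_) ys) ≡ count R? [ x ]) →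
                             ∀ xs → count P? (cartesianProduct xs ys) ≡ count R? xs
    count-cartesianProduct row [] = refl
    count-cartesianProduct row (x ∷ xs) = begin
      length (filter P? (map (x ,_) ys ++ cartesianProduct xs ys))
        ≡⟨ cong length (filter-++ P? (map (x ,_) ys) (cartesianProduct xs ys)) ⟩
      length (filter P? (map (x ,_) ys) ++ filter P? (cartesianProduct xs ys))
        ≡⟨ length-++ (filter P? (map (x ,_) ys)) ⟩
      count P? (map (x ,_) ys) + count P? (cartesianProduct xs ys)
        ≡⟨ cong₂ _+_ (row x) (count-cartesianProduct row xs) ⟩
      count R? [ x ] + count R? xs
        ≡⟨ sym (length-++ (filter R? [ x ])) ⟩
      length (filter R? [ x ] ++ filter R? xs)
        ≡⟨ cong length (sym (filter-++ R? [ x ] xs)) ⟩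
      count R? (x ∷ xs) ∎
      where open ≡-Reasoning

-- The ring's own equality cannot be decided by evaluation, which the solver needs to
-- normalise coefficients, so coefficients are integers interpreted in R by fromℤ.
module IntegerCoefficientSolver {c ℓ : Level} (R : CommutativeRing c ℓ) where

  open import Data.Nat as ℕ using (ℕ; zero; suc)
  import Data.Nat.Properties as ℕ
  open import Data.Integer as ℤ using (ℤ; +_; -[1+_])
  import Data.Integer.Properties as ℤ
  open import Data.Sign as Sign using (Sign)
  open import Data.Maybe using (Maybe; just; nothing)
  open import Relation.Nullary using (yes; no)
  open import Relation.Binary.PropositionalEquality using (_≡_; cong)
  open import Algebra.Solver.Ring.AlmostCommutativeRing
    using (_-Raw-AlmostCommutative⟶_; fromCommutativeRing)

  open CommutativeRing R
  open import Algebra.Properties.Semiring.Mult.TCOptimised semiring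
    using (×-homo-+; ×1-homo-*; 1+×) renaming (_×_ to _·_)
  open import Algebra.Properties.Ring ring using (-‿distribˡ-*; -‿distribʳ-*; -‿involutive; -0#≈0#)
  open import Algebra.Properties.AbelianGroup +-abelianGroup using (⁻¹-∙-comm; xyx⁻¹≈y)
  open import Relation.Binary.Reasoning.Setoid setoid

  fromℕ : ℕ → Carrier
  fromℕ n = n · 1#

  fromℤ : ℤ → Carrier
  fromℤ (+ n)    = fromℕ n
  fromℤ -[1+ n ] = - fromℕ (suc n)

  signed : Sign → Carrier → Carrier
  signed Sign.+ x = x
  signed Sign.- x = - x

  fromℤ-sign-abs : ∀ i → fromℤ i ≈ signed (ℤ.sign i) (fromℕ ℤ.∣ i ∣)
  fromℤ-sign-abs (+ n)    = refl
  fromℤ-sign-abs -[1+ n ] = refl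

  fromℤ-◃ : ∀ s n → fromℤ (s ℤ.◃ n) ≈ signed s (fromℕ n)
  fromℤ-◃ Sign.- zero    = sym -0#≈0#
  fromℤ-◃ Sign.+ zero    = refl
  fromℤ-◃ Sign.- (suc n) = refl
  fromℤ-◃ Sign.+ (suc n) = refl

  fromℤ-⊖ : ∀ m n → fromℤ (m ℤ.⊖ n) ≈ fromℕ m - fromℕ n
  fromℤ-⊖ m       zero    = sym (trans (+-congˡ -0#≈0#) (+-identityʳ _))
  fromℤ-⊖ zero    (suc n) = sym (+-identityˡ _)
  fromℤ-⊖ (suc m) (suc n) = begin
    fromℤ (suc m ℤ.⊖ suc n)              ≡⟨ cong fromℤ (ℤ.[1+m]⊖[1+n]≡m⊖n m n) ⟩
    fromℤ (m ℤ.⊖ n)                      ≈⟨ fromℤ-⊖ m n ⟩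
    fromℕ m - fromℕ n                    ≈⟨ +-congʳ (xyx⁻¹≈y 1# (fromℕ m)) ⟨
    (1# + fromℕ m - 1#) - fromℕ n        ≈⟨ +-assoc (1# + fromℕ m) (- 1#) (- fromℕ n) ⟩
    (1# + fromℕ m) + (- 1# - fromℕ n)    ≈⟨ +-congˡ (⁻¹-∙-comm 1# (fromℕ n)) ⟩
    (1# + fromℕ m) - (1# + fromℕ n)      ≈⟨ +-cong (1+× m 1#) (-‿cong (1+× n 1#)) ⟨
    fromℕ (suc m) - fromℕ (suc n)        ∎

  fromℤ-homo-+ : ∀ i j → fromℤ (i ℤ.+ j) ≈ fromℤ i + fromℤ j
  fromℤ-homo-+ -[1+ m ] -[1+ n ] = begin
    - fromℕ (suc (suc (m ℕ.+ n)))         ≡⟨ cong (λ k → - fromℕ k) (ℕ.+-suc (suc m) n) ⟨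
    - fromℕ (suc m ℕ.+ suc n)             ≈⟨ -‿cong (×-homo-+ 1# (suc m) (suc n)) ⟩
    - (fromℕ (suc m) + fromℕ (suc n))     ≈⟨ ⁻¹-∙-comm _ _ ⟨
    - fromℕ (suc m) - fromℕ (suc n)       ∎
  fromℤ-homo-+ -[1+ m ] (+ n)    = trans (fromℤ-⊖ n (suc m)) (+-comm _ _)
  fromℤ-homo-+ (+ m)    -[1+ n ] = fromℤ-⊖ m (suc n)
  fromℤ-homo-+ (+ m)    (+ n)    = ×-homo-+ 1# m n

  signed-* : ∀ s t x y → signed (s Sign.* t) (x * y) ≈ signed s x * signed t y
  signed-* Sign.- Sign.- x y = begin
    x * y           ≈⟨ -‿involutive (x * y) ⟨
    - - (x * y)     ≈⟨ -‿cong (-‿distribˡ-* x y) ⟩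
    - (- x * y)     ≈⟨ -‿distribʳ-* (- x) y ⟩
    - x * - y       ∎
  signed-* Sign.- Sign.+ x y = -‿distribˡ-* x y
  signed-* Sign.+ Sign.- x y = -‿distribʳ-* x y
  signed-* Sign.+ Sign.+ x y = refl

  signed-cong : ∀ s {x y} → x ≈ y → signed s x ≈ signed s y
  signed-cong Sign.+ x≈y = x≈y
  signed-cong Sign.- x≈y = -‿cong x≈y

  fromℤ-homo-* : ∀ i j → fromℤ (i ℤ.* j) ≈ fromℤ i * fromℤ j
  fromℤ-homo-* i j = begin
    fromℤ (s ℤ.◃ ℤ.∣ i ∣ ℕ.* ℤ.∣ j ∣)                  ≈⟨ fromℤ-◃ s (ℤ.∣ i ∣ ℕ.* ℤ.∣ j ∣) ⟩
    signed s (fromℕ (ℤ.∣ i ∣ ℕ.* ℤ.∣ j ∣))            ≈⟨ signed-cong s (×1-homo-* ℤ.∣ i ∣ ℤ.∣ j ∣) ⟩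
    signed s (fromℕ ℤ.∣ i ∣ * fromℕ ℤ.∣ j ∣)          ≈⟨ signed-* (ℤ.sign i) (ℤ.sign j) _ _ ⟩
    signed (ℤ.sign i) (fromℕ ℤ.∣ i ∣) * signed (ℤ.sign j) (fromℕ ℤ.∣ j ∣)
                                                       ≈⟨ *-cong (fromℤ-sign-abs i) (fromℤ-sign-abs j) ⟨
    fromℤ i * fromℤ j                                  ∎
    where s = ℤ.sign i Sign.* ℤ.sign j

  fromℤ-homo-‿ : ∀ i → fromℤ (ℤ.- i) ≈ - fromℤ i
  fromℤ-homo-‿ -[1+ n ]    = sym (-‿involutive _)
  fromℤ-homo-‿ (+ zero)    = sym -0#≈0#
  fromℤ-homo-‿ (+ suc n)   = refl

  fromℤ-homomorphism : ℤ.+-*-rawRing -Raw-AlmostCommutative⟶ fromCommutativeRing R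
  fromℤ-homomorphism = record
    { ⟦_⟧    = fromℤ
    ; +-homo = fromℤ-homo-+
    ; *-homo = fromℤ-homo-*
    ; -‿homo = fromℤ-homo-‿
    ; 0-homo = refl
    ; 1-homo = refl
    }

  fromℤ-≟ : ∀ i j → Maybe (fromℤ i ≈ fromℤ j)
  fromℤ-≟ i j with i ℤ.≟ j
  ... | yes i≡j = just (reflexive (cong fromℤ i≡j))
  ... | no _    = nothing

  open import Algebra.Solver.Ring ℤ.+-*-rawRing (fromCommutativeRing R) fromℤ-homomorphism fromℤ-≟ public

module FieldProperties {c ℓ : Level} {q : ℕ} (K : FiniteField c ℓ q) where

  open FiniteField K
  open IntegerCoefficientSolver commRing using (solve; _:=_; _:+_; _:*_; _:-_)
  open import Algebra.Properties.Group +-group public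
    using () renaming (x∙y⁻¹≈ε⇒x≈y to x-y≈0⇒x≈y; x≈y⇒x∙y⁻¹≈ε to x≈y⇒x-y≈0)
  open import Algebra.Properties.Ring ring using (-0#≈0#)
  import Relation.Binary.Reasoning.Setoid setoid as ≈-Reasoning

  private variable x y z : Carrier

  +-≈0 : x ≈ 0# → y ≈ 0# → x + y ≈ 0#
  +-≈0 x≈0 y≈0 = trans (+-cong x≈0 y≈0) (+-identityˡ 0#)

  -‿≈0 : x ≈ 0# → - x ≈ 0#
  -‿≈0 x≈0 = trans (-‿cong x≈0) -0#≈0#

  *-≈0ˡ : ∀ y → x ≈ 0# → x * y ≈ 0#
  *-≈0ˡ y x≈0 = trans (*-congʳ x≈0) (zeroˡ y)

  *-≈0ʳ : ∀ x → y ≈ 0# → x * y ≈ 0#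
  *-≈0ʳ x y≈0 = trans (*-congˡ y≈0) (zeroʳ x)

  x*y≈0⇒y≈0 : ¬ x ≈ 0# → x * y ≈ 0# → y ≈ 0#
  x*y≈0⇒y≈0 {x} {y} x≉0 xy≈0 = begin
    y                ≈⟨ *-identityˡ y ⟨
    1# * y           ≈⟨ *-congʳ (inverseʳ x x≉0) ⟨
    x * x ⁻¹ * y     ≈⟨ solve 3 (λ x x⁻¹ y → x :* x⁻¹ :* y := x⁻¹ :* (x :* y)) refl x (x ⁻¹) y ⟩
    x ⁻¹ * (x * y)   ≈⟨ *-≈0ʳ (x ⁻¹) xy≈0 ⟩
    0#               ∎
    where open ≈-Reasoning

  *-≉0 : ¬ x ≈ 0# → ¬ y ≈ 0# → ¬ x * y ≈ 0#
  *-≉0 x≉0 y≉0 xy≈0 = y≉0 (x*y≈0⇒y≈0 x≉0 xy≈0)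

  -‿≉0 : ¬ x ≈ y → ¬ x - y ≈ 0#
  -‿≉0 x≉y x-y≈0 = x≉y (x-y≈0⇒x≈y _ _ x-y≈0)

  *-cancelˡ : ¬ z ≈ 0# → z * x ≈ z * y → x ≈ y
  *-cancelˡ {z} {x} {y} z≉0 zx≈zy = x-y≈0⇒x≈y x y (x*y≈0⇒y≈0 z≉0 (begin
    z * (x - y)       ≈⟨ solve 3 (λ z x y → z :* (x :- y) := z :* x :- z :* y) refl z x y ⟩
    z * x - z * y     ≈⟨ x≈y⇒x-y≈0 zx≈zy ⟩
    0#                ∎))
    where open ≈-Reasoning

  z*[x*z⁻¹]≈x : ¬ z ≈ 0# → z * (x * z ⁻¹) ≈ x
  z*[x*z⁻¹]≈x {z} {x} z≉0 = begin
    z * (x * z ⁻¹)    ≈⟨ solve 3 (λ z x z⁻¹ → z :* (x :* z⁻¹) := x :* (z :* z⁻¹)) refl z x (z ⁻¹) ⟩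
    x * (z * z ⁻¹)    ≈⟨ *-congˡ (inverseʳ z z≉0) ⟩
    x * 1#            ≈⟨ *-identityʳ x ⟩
    x                 ∎
    where open ≈-Reasoning

  slope-relations⇒a²+ab+b²≈0 : ∀ {a b U V} → ¬ U ≈ 0# → ¬ V ≈ 0# →
    (a + b) * U ≈ a * V → (b + a) * V ≈ b * U → a * a + a * b + b * b ≈ 0#
  slope-relations⇒a²+ab+b²≈0 {a} {b} {U} {V} U≉0 V≉0 rel₁ rel₂ = x*y≈0⇒y≈0 (*-≉0 U≉0 V≉0) (begin
    U * V * (a * a + a * b + b * b)             ≈⟨ solve 4 (λ a b U V → U :* V :* (a :* a :+ a :* b :+ b :* b)
                                                     := (a :+ b) :* U :* ((b :+ a) :* V) :- a :* V :* (b :* U)) refl a b U V ⟩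
    (a + b) * U * ((b + a) * V) - a * V * (b * U) ≈⟨ +-congʳ (*-cong rel₁ rel₂) ⟩
    a * V * (b * U) - a * V * (b * U)           ≈⟨ x≈y⇒x-y≈0 refl ⟩
    0#                                          ∎)
    where open ≈-Reasoning

  a²+ab+b²≈0-sym : ∀ {a b} → a * a + a * b + b * b ≈ 0# → b * b + b * a + a * a ≈ 0#
  a²+ab+b²≈0-sym {a} {b} = trans (solve 2 (λ a b → b :* b :+ b :* a :+ a :* a := a :* a :+ a :* b :+ b :* b) refl a b)

  a²+ab+b²≈0⇒root : ∀ {a b} → ¬ b ≈ 0# → a * a + a * b + b * b ≈ 0# →
    (a * b ⁻¹) * (a * b ⁻¹) + a * b ⁻¹ + 1# ≈ 0#
  a²+ab+b²≈0⇒root {a} {b} b≉0 a²+ab+b²≈0 = begin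
    t * t + t + 1#                                   ≈⟨ +-cong (+-congˡ (*-identityʳ t)) (*-identityˡ 1#) ⟨
    t * t + t * 1# + 1# * 1#                         ≈⟨ +-cong (+-congˡ (*-congˡ bb⁻¹≈1)) (*-cong bb⁻¹≈1 bb⁻¹≈1) ⟨
    t * t + t * (b * b ⁻¹) + (b * b ⁻¹) * (b * b ⁻¹) ≈⟨ solve 3 (λ a b b⁻¹ →
                                                          a :* b⁻¹ :* (a :* b⁻¹) :+ a :* b⁻¹ :* (b :* b⁻¹) :+ b :* b⁻¹ :* (b :* b⁻¹)
                                                          := (a :* a :+ a :* b :+ b :* b) :* (b⁻¹ :* b⁻¹)) refl a b (b ⁻¹) ⟩
    (a * a + a * b + b * b) * (b ⁻¹ * b ⁻¹)          ≈⟨ *-≈0ˡ (b ⁻¹ * b ⁻¹) a²+ab+b²≈0 ⟩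
    0#                                               ∎
    where
    open ≈-Reasoning
    t = a * b ⁻¹
    bb⁻¹≈1 = inverseʳ b b≉0

  a²+ab+b²≈0⇒ratios-distinct : ∀ {a b} → ¬ a ≈ 0# → ¬ b ≈ 0# → ¬ a ≈ b → a * a + a * b + b * b ≈ 0# →
    ¬ a * b ⁻¹ ≈ b * a ⁻¹
  a²+ab+b²≈0⇒ratios-distinct {a} {b} a≉0 b≉0 a≉b a²+ab+b²≈0 ab⁻¹≈ba⁻¹ = a≉0 (x*y≈0⇒y≈0 a≉0 a²≈0)
    where
    open ≈-Reasoning
    a²≈b² : a * a ≈ b * b
    a²≈b² = begin
      a * a                    ≈⟨ *-identityʳ (a * a) ⟨
      a * a * 1#               ≈⟨ *-congˡ (inverseʳ b b≉0) ⟨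
      a * a * (b * b ⁻¹)       ≈⟨ solve 3 (λ a b b⁻¹ → a :* a :* (b :* b⁻¹) := a :* b⁻¹ :* (a :* b)) refl a b (b ⁻¹) ⟩
      a * b ⁻¹ * (a * b)       ≈⟨ *-congʳ ab⁻¹≈ba⁻¹ ⟩
      b * a ⁻¹ * (a * b)       ≈⟨ solve 3 (λ a b a⁻¹ → b :* a⁻¹ :* (a :* b) := b :* b :* (a :* a⁻¹)) refl a b (a ⁻¹) ⟩
      b * b * (a * a ⁻¹)       ≈⟨ *-congˡ (inverseʳ a a≉0) ⟩
      b * b * 1#               ≈⟨ *-identityʳ (b * b) ⟩
      b * b                    ∎
    a+b≈0 : a + b ≈ 0#
    a+b≈0 = x*y≈0⇒y≈0 (-‿≉0 a≉b) (begin
      (a - b) * (a + b)        ≈⟨ solve 2 (λ a b → (a :- b) :* (a :+ b) := a :* a :- b :* b) refl a b ⟩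
      a * a - b * b            ≈⟨ x≈y⇒x-y≈0 a²≈b² ⟩
      0#                       ∎)
    a²≈0 : a * a ≈ 0#
    a²≈0 = begin
      a * a                                ≈⟨ solve 2 (λ a b → a :* a := a :* a :+ a :* b :+ b :* b :- b :* (a :+ b)) refl a b ⟩
      a * a + a * b + b * b - b * (a + b)  ≈⟨ +-≈0 a²+ab+b²≈0 (-‿≈0 (*-≈0ʳ b a+b≈0)) ⟩
      0#                                   ∎

module Cardinality where

  open import Data.Nat using (zero; suc; _≤_; _%_; z≤n; s≤s)
  open import Data.Fin using (Fin; zero)
  open import Relation.Binary.PropositionalEquality using (_≡_; _≢_; refl)

  i≢j⇒2≤n : ∀ {n} {i j : Fin n} → i ≢ j → 2 ≤ n
  i≢j⇒2≤n {suc zero}    {zero} {zero} i≢j with () ← i≢j refl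
  i≢j⇒2≤n {suc (suc n)} _ = s≤s (s≤s z≤n)

  2≤n∧n%3≡1⇒4≤n : ∀ n → 2 ≤ n → n % 3 ≡ 1 → 4 ≤ n
  2≤n∧n%3≡1⇒4≤n 0 () _
  2≤n∧n%3≡1⇒4≤n 1 (s≤s ()) _
  2≤n∧n%3≡1⇒4≤n 2 _ ()
  2≤n∧n%3≡1⇒4≤n 3 _ ()
  2≤n∧n%3≡1⇒4≤n (suc (suc (suc (suc n)))) _ _ = s≤s (s≤s (s≤s (s≤s z≤n)))

module ContractionGraph {c ℓ : Level} {q : ℕ} (K : FiniteField c ℓ q) where

  open import Function using (_∘_; id)
  open import Function.Definitions using (Congruent; Injective)
  open import Data.Nat as ℕ using (_≤_; _<_)
  open Cardinality
  import Data.Nat.Properties as ℕ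
  open import Data.Fin using (Fin)
  open import Data.List using (length; allFin; tabulate; [_])
  open import Data.List.Properties using (length-tabulate; filter-≐; filter-accept; filter-reject; map-tabulate)
  open import Data.Product using (_,_; proj₁; proj₂)
  open import Data.Sum using (inj₁; inj₂)
  open import Data.Empty using (⊥-elim)
  open import Relation.Nullary using (Dec; yes; no)
  open import Relation.Nullary.Decidable using (¬?; _×-dec_; decidable-stable)
  open import Relation.Unary using (Pred; Decidable; _⊆_; _∪_)
  open import Relation.Unary.Properties using (∁?; _∪?_)
  open import Relation.Binary.Definitions using (_Respects_)
  import Relation.Binary.PropositionalEquality as ≡
  open ≡ using (_≢_)
  open FiniteField K
  open import Algebra.Properties.Group +-group using (∙-cancelˡ; ∙-cancelʳ)
  open FieldProperties K
  open Counting
  open IntegerCoefficientSolver commRing using (solve; _:=_; _:+_; _:*_; _:-_)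
  import Relation.Binary.Reasoning.Setoid setoid as ≈-Reasoning

  private variable u x : Carrier

  AtMostOne : Pred Carrier ℓ → Set (c Level.⊔ ℓ)
  AtMostOne P = ∀ {x y} → P x → P y → x ≈ y

  #_ : {P : Pred Carrier ℓ} → Decidable P → ℕ
  # P? = count (P? ∘ enum) (allFin q)

  module _ {P : Pred Carrier ℓ} (P? : Decidable P) where

    #-+-#∁ : # P? ℕ.+ # (∁? P?) ≡ q
    #-+-#∁ = ≡.trans (count-+-count-∁ (P? ∘ enum) (allFin q)) (length-tabulate _)

    #≤1 : AtMostOne P → # P? ≤ 1
    #≤1 unique = count-tabulate≤1 (P? ∘ enum) _ λ i j pi pj → enum-inj i j (unique pi pj)

    #≥1 : P Respects _≈_ → P x → 1 ≤ # P?
    #≥1 {x} resp px with enum-sur x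
    ... | i , enum-i≈x = count-tabulate≥1 (P? ∘ enum) _ i (resp (sym enum-i≈x) px)

    #∁≡q∸1 : P Respects _≈_ → AtMostOne P → P x → # (∁? P?) ≡ q ∸ 1
    #∁≡q∸1 resp unique px = ≡.trans (≡.sym (ℕ.m+n∸m≡n (# P?) (# (∁? P?))))
      (≡.cong₂ _∸_ #-+-#∁ (ℕ.≤-antisym (#≤1 unique) (#≥1 resp px)))

    #∁≡q∸n⇒#≡n : ∀ {n} → n ≤ q → # (∁? P?) ≡ q ∸ n → # P? ≡ n
    #∁≡q∸n⇒#≡n {n} n≤q #∁≡q∸n = ℕ.+-cancelʳ-≡ (q ∸ n) (# P?) n (begin
      # P? ℕ.+ (q ∸ n)      ≡⟨ ≡.cong (# P? ℕ.+_) #∁≡q∸n ⟨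
      # P? ℕ.+ # (∁? P?)    ≡⟨ #-+-#∁ ⟩
      q                     ≡⟨ ℕ.m+[n∸m]≡n n≤q ⟨
      n ℕ.+ (q ∸ n)         ∎)
      where open ≡.≡-Reasoning

  #≤3 : {P Q₁ Q₂ Q₃ : Pred Carrier ℓ} (P? : Decidable P)
        (Q₁? : Decidable Q₁) (Q₂? : Decidable Q₂) (Q₃? : Decidable Q₃) →
        P ⊆ Q₁ ∪ Q₂ ∪ Q₃ → AtMostOne Q₁ → AtMostOne Q₂ → AtMostOne Q₃ → # P? ≤ 3
  #≤3 P? Q₁? Q₂? Q₃? cover unique₁ unique₂ unique₃ = begin
    # P?                         ≤⟨ count-mono (P? ∘ enum) (Q₁₂₃? ∘ enum) cover (allFin q) ⟩
    # Q₁₂₃?                      ≤⟨ count-∪ (Q₁? ∘ enum) (Q₂₃? ∘ enum) (allFin q) ⟩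
    # Q₁? ℕ.+ # Q₂₃?             ≤⟨ ℕ.+-monoʳ-≤ (# Q₁?) (count-∪ (Q₂? ∘ enum) (Q₃? ∘ enum) (allFin q)) ⟩
    # Q₁? ℕ.+ (# Q₂? ℕ.+ # Q₃?)  ≤⟨ ℕ.+-mono-≤ (#≤1 Q₁? unique₁) (ℕ.+-mono-≤ (#≤1 Q₂? unique₂) (#≤1 Q₃? unique₃)) ⟩
    3                            ∎
    where
    open ℕ.≤-Reasoning
    Q₂₃? = Q₂? ∪? Q₃?
    Q₁₂₃? = Q₁? ∪? Q₂₃?

  module _ (F : Carrier) (f : Carrier → Carrier) where

    contract-preimage : ¬ x ≈ F → f x ≈ F → contract K F f x ≡ f F
    contract-preimage {x} x≉F fx≈F with x ≟ F
    ... | yes x≈F = ⊥-elim (x≉F x≈F)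
    ... | no _ with f x ≟ F
    ...   | yes _    = ≡.refl
    ...   | no fx≉F  = ⊥-elim (fx≉F fx≈F)

    contract-other : ¬ x ≈ F → ¬ f x ≈ F → contract K F f x ≡ f x
    contract-other {x} x≉F fx≉F with x ≟ F
    ... | yes x≈F = ⊥-elim (x≉F x≈F)
    ... | no _ with f x ≟ F
    ...   | yes fx≈F = ⊥-elim (fx≉F fx≈F)
    ...   | no _     = ≡.refl

  Agree : (Carrier → Carrier) → (Carrier → Carrier) → Pred Carrier ℓ
  Agree f g x = f x ≈ g x

  agree? : (f g : Carrier → Carrier) → Decidable (Agree f g)
  agree? f g x = f x ≟ g x

  module Contraction (F : Carrier) {f g : Carrier → Carrier}
                     (f-cong : Congruent _≈_ _≈_ f) (g-cong : Congruent _≈_ _≈_ g)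
                     (f-injective : Injective _≈_ _≈_ f) (g-injective : Injective _≈_ _≈_ g) where

    f△ g△ : Carrier → Carrier
    f△ = contract K F f
    g△ = contract K F g

    #agree△ : ℕ
    #agree△ = # agree? f△ g△

    _≈F : Pred Carrier ℓ
    x ≈F = x ≈ F

    f⁻¹F g⁻¹F : Pred Carrier ℓ
    f⁻¹F x = f x ≈ F
    g⁻¹F x = g x ≈ F

    agree△⊆ : Agree f△ g△ ⊆ _≈F ∪ f⁻¹F ∪ g⁻¹F ∪ Agree f g
    agree△⊆ {x} f△x≈g△x with x ≟ F
    ... | yes x≈F = inj₁ x≈F
    ... | no _ with f x ≟ F
    ...   | yes fx≈F = inj₂ (inj₁ fx≈F)
    ...   | no _ with g x ≟ F
    ...     | yes gx≈F = inj₂ (inj₂ (inj₁ gx≈F))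
    ...     | no _     = inj₂ (inj₂ (inj₂ f△x≈g△x))

    F-unique : AtMostOne _≈F
    F-unique x≈F y≈F = trans x≈F (sym y≈F)

    f⁻¹F-unique : AtMostOne f⁻¹F
    f⁻¹F-unique fx≈F fy≈F = f-injective (trans fx≈F (sym fy≈F))

    g⁻¹F-unique : AtMostOne g⁻¹F
    g⁻¹F-unique gx≈F gy≈F = g-injective (trans gx≈F (sym gy≈F))

    #agree△≤3-if-disjoint : (∀ x → ¬ f x ≈ g x) → #agree△ ≤ 3
    #agree△≤3-if-disjoint f≉g =
      #≤3 (agree? f△ g△) (_≟ F) (λ x → f x ≟ F) (λ x → g x ≟ F) (drop ∘ agree△⊆) F-unique f⁻¹F-unique g⁻¹F-unique
      where
      drop : _≈F ∪ f⁻¹F ∪ g⁻¹F ∪ Agree f g ⊆ _≈F ∪ f⁻¹F ∪ g⁻¹F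
      drop (inj₁ x≈F)                  = inj₁ x≈F
      drop (inj₂ (inj₁ fx≈F))          = inj₂ (inj₁ fx≈F)
      drop (inj₂ (inj₂ (inj₁ gx≈F)))   = inj₂ (inj₂ gx≈F)
      drop (inj₂ (inj₂ (inj₂ fx≈gx)))  = ⊥-elim (f≉g _ fx≈gx)

    module _ (f≈g-unique : AtMostOne (Agree f g)) where

      #agree△≤3-if-F-fixed : f F ≈ F → #agree△ ≤ 3
      #agree△≤3-if-F-fixed fF≈F =
        #≤3 (agree? f△ g△) (_≟ F) (λ x → g x ≟ F) (agree? f g) (merge ∘ agree△⊆) F-unique g⁻¹F-unique f≈g-unique
        where
        merge : _≈F ∪ f⁻¹F ∪ g⁻¹F ∪ Agree f g ⊆ _≈F ∪ g⁻¹F ∪ Agree f g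
        merge (inj₁ x≈F)          = inj₁ x≈F
        merge (inj₂ (inj₁ fx≈F))  = inj₁ (f-injective (trans fx≈F (sym fF≈F)))
        merge (inj₂ (inj₂ rest))  = inj₂ rest

      #agree△≤3-if-common-preimage : f u ≈ F → g u ≈ F → #agree△ ≤ 3
      #agree△≤3-if-common-preimage {u} fu≈F gu≈F =
        #≤3 (agree? f△ g△) (_≟ F) (λ x → f x ≟ F) (agree? f g) (merge ∘ agree△⊆) F-unique f⁻¹F-unique f≈g-unique
        where
        merge : _≈F ∪ f⁻¹F ∪ g⁻¹F ∪ Agree f g ⊆ _≈F ∪ f⁻¹F ∪ Agree f g
        merge (inj₁ x≈F)                 = inj₁ x≈F
        merge (inj₂ (inj₁ fx≈F))         = inj₂ (inj₁ fx≈F)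
        merge (inj₂ (inj₂ (inj₁ gx≈F)))  = inj₂ (inj₁ (trans (f-cong (g-injective (trans gx≈F (sym gu≈F)))) fu≈F))
        merge (inj₂ (inj₂ (inj₂ fx≈gx))) = inj₂ (inj₂ fx≈gx)

      #agree△≤3-if-mismatch : f u ≈ F → ¬ g u ≈ F → ¬ f F ≈ g u → #agree△ ≤ 3
      #agree△≤3-if-mismatch {u} fu≈F gu≉F fF≉gu =
        #≤3 (agree? f△ g△) (_≟ F) (λ x → g x ≟ F) (agree? f g) (λ agree → merge agree (agree△⊆ agree))
          F-unique g⁻¹F-unique f≈g-unique
        where
        merge : ∀ {x} → f△ x ≈ g△ x → (_≈F ∪ f⁻¹F ∪ g⁻¹F ∪ Agree f g) x → (_≈F ∪ g⁻¹F ∪ Agree f g) x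
        merge _ (inj₁ x≈F)         = inj₁ x≈F
        merge {x} f△x≈g△x (inj₂ (inj₁ fx≈F)) = inj₁ (decidable-stable (x ≟ F) λ x≉F → fF≉gu (begin
          f F     ≡⟨ contract-preimage F f x≉F fx≈F ⟨
          f△ x    ≈⟨ f△x≈g△x ⟩
          g△ x    ≡⟨ contract-other F g x≉F gx≉F ⟩
          g x     ≈⟨ g-cong x≈u ⟩
          g u     ∎))
          where
          open ≈-Reasoning
          x≈u = f-injective (trans fx≈F (sym fu≈F))
          gx≉F : ¬ g x ≈ F
          gx≉F gx≈F = gu≉F (trans (g-cong (sym x≈u)) gx≈F)
        merge _ (inj₂ (inj₂ rest)) = inj₂ rest

      module _ (3<#agree△ : 3 < #agree△) where

        f[F]≉F : ¬ f F ≈ F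
        f[F]≉F fF≈F = ℕ.<⇒≱ 3<#agree△ (#agree△≤3-if-F-fixed fF≈F)

        f[F]≈g[u] : f u ≈ F → f F ≈ g u
        f[F]≈g[u] {u} fu≈F = decidable-stable (f F ≟ g u) λ fF≉gu →
          ℕ.<⇒≱ 3<#agree△ (#agree△≤3-if-mismatch fu≈F gu≉F fF≉gu)
          where
          gu≉F : ¬ g u ≈ F
          gu≉F gu≈F = ℕ.<⇒≱ 3<#agree△ (#agree△≤3-if-common-preimage fu≈F gu≈F)

  open AGL

  ⟦⟧-cong : ∀ π → Congruent _≈_ _≈_ (⟦ K ⟧ π)
  ⟦⟧-cong π x≈y = +-congʳ (*-congˡ x≈y)

  ⟦⟧-injective : ∀ π → Injective _≈_ _≈_ (⟦ K ⟧ π)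
  ⟦⟧-injective π {x} {y} πx≈πy = *-cancelˡ (coef≉0 π) (∙-cancelʳ (shift π) (coef π * x) (coef π * y) πx≈πy)

  preimage : AGL K → Carrier → Carrier
  preimage π y = (y - shift π) * coef π ⁻¹

  ⟦⟧-preimage : ∀ π y → ⟦ K ⟧ π (preimage π y) ≈ y
  ⟦⟧-preimage π y = begin
    coef π * ((y - shift π) * coef π ⁻¹) + shift π  ≈⟨ +-congʳ (z*[x*z⁻¹]≈x (coef≉0 π)) ⟩
    y - shift π + shift π                          ≈⟨ solve 2 (λ y s → y :- s :+ s := y) refl y (shift π) ⟩
    y                                              ∎
    where open ≈-Reasoning

  Agree-resp : ∀ π σ → Agree (⟦ K ⟧ π) (⟦ K ⟧ σ) Respects _≈_
  Agree-resp π σ x≈y πx≈σx = trans (⟦⟧-cong π (sym x≈y)) (trans πx≈σx (⟦⟧-cong σ x≈y))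

  Agree-unique : ∀ π σ → ¬ coef σ ≈ coef π → AtMostOne (Agree (⟦ K ⟧ π) (⟦ K ⟧ σ))
  Agree-unique π σ a≉b {x} {y} πx≈σx πy≈σy = x-y≈0⇒x≈y x y (x*y≈0⇒y≈0 (-‿≉0 (a≉b ∘ sym)) (begin
    (b - a) * (x - y)                            ≈⟨ solve 6 (λ a b r s x y → (b :- a) :* (x :- y)
                                                      := (b :* x :+ s :- (a :* x :+ r)) :- (b :* y :+ s :- (a :* y :+ r)))
                                                      refl a b (shift σ) (shift π) x y ⟩
    (⟦ K ⟧ π x - ⟦ K ⟧ σ x) - (⟦ K ⟧ π y - ⟦ K ⟧ σ y) ≈⟨ +-≈0 (x≈y⇒x-y≈0 πx≈σx) (-‿≈0 (x≈y⇒x-y≈0 πy≈σy)) ⟩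
    0#                                           ∎))
    where
    open ≈-Reasoning
    a = coef σ
    b = coef π

  intersection : AGL K → AGL K → Carrier
  intersection π σ = (shift σ - shift π) * (coef π - coef σ) ⁻¹

  Agree-intersection : ∀ π σ → ¬ coef σ ≈ coef π → Agree (⟦ K ⟧ π) (⟦ K ⟧ σ) (intersection π σ)
  Agree-intersection π σ a≉b = x-y≈0⇒x≈y _ _ (begin
    ⟦ K ⟧ π x₀ - ⟦ K ⟧ σ x₀     ≈⟨ solve 5 (λ a b r s x → (b :* x :+ s) :- (a :* x :+ r) := (b :- a) :* x :- (r :- s))
                                      refl a b r s x₀ ⟩
    (b - a) * x₀ - (r - s)     ≈⟨ x≈y⇒x-y≈0 (z*[x*z⁻¹]≈x (-‿≉0 (a≉b ∘ sym))) ⟩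
    0#                         ∎)
    where
    open ≈-Reasoning
    a = coef σ
    b = coef π
    r = shift σ
    s = shift π
    x₀ = intersection π σ

  same-slope-Agree⇒≈AGL : ∀ π σ → coef π ≈ coef σ → Agree (⟦ K ⟧ π) (⟦ K ⟧ σ) x → _≈AGL_ K π σ
  same-slope-Agree⇒≈AGL π σ b≈a πx≈σx =
    b≈a , ∙-cancelˡ _ (shift π) (shift σ) (trans πx≈σx (+-congʳ (*-congʳ (sym b≈a))))

  hd-⟦⟧ : ∀ π σ → ¬ coef σ ≈ coef π → hd K (⟦ K ⟧ π) (⟦ K ⟧ σ) ≡ q ∸ 1
  hd-⟦⟧ π σ a≉b =
    #∁≡q∸1 (agree? (⟦ K ⟧ π) (⟦ K ⟧ σ)) (Agree-resp π σ) (Agree-unique π σ a≉b) (Agree-intersection π σ a≉b)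

  hd-sym : ∀ f g → hd K f g ≡ hd K g f
  hd-sym f g = ≡.cong length (filter-≐ _ _ ((_∘ sym) , (_∘ sym)) (allFin q))

  Adjacent-sym : ∀ F π σ → Adjacent K F π σ → Adjacent K F σ π
  Adjacent-sym F π σ (π≉σ , hd≡q∸4) =
    (λ (a≈b , r≈s) → π≉σ (sym a≈b , sym r≈s)) , ≡.trans (hd-sym (contract K F (⟦ K ⟧ σ)) (contract K F (⟦ K ⟧ π))) hd≡q∸4

  ⟦⟧-collision : ∀ {F u v} π σ → ⟦ K ⟧ π u ≈ F → ⟦ K ⟧ σ v ≈ F → ⟦ K ⟧ π F ≈ ⟦ K ⟧ σ u →
                 (coef σ + coef π) * (u - F) ≈ coef σ * (v - F)
  ⟦⟧-collision {F} {u} {v} π σ πu≈F σv≈F πF≈σu = x-y≈0⇒x≈y _ _ (begin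
    (a + b) * (u - F) - a * (v - F)
      ≈⟨ solve 7 (λ a b r s u v F → (a :+ b) :* (u :- F) :- a :* (v :- F)
           := (a :* u :+ r :- (b :* F :+ s)) :+ (b :* u :+ s :- F) :- (a :* v :+ r :- F)) refl a b r s u v F ⟩
    (⟦ K ⟧ σ u - ⟦ K ⟧ π F) + (⟦ K ⟧ π u - F) - (⟦ K ⟧ σ v - F)
      ≈⟨ +-≈0 (+-≈0 (x≈y⇒x-y≈0 (sym πF≈σu)) (x≈y⇒x-y≈0 πu≈F)) (-‿≈0 (x≈y⇒x-y≈0 σv≈F)) ⟩
    0# ∎)
    where
    open ≈-Reasoning
    a = coef σ
    b = coef π
    r = shift σ
    s = shift π

  module Adjacency (4≤q : 4 ≤ q) (F : Carrier) where

    module _ (π σ : AGL K) (adjacent : Adjacent K F π σ) where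
      open Contraction F (⟦⟧-cong π) (⟦⟧-cong σ) (⟦⟧-injective π) (⟦⟧-injective σ)

      3<#agree△ : 3 < #agree△
      3<#agree△ = ℕ.≤-reflexive (≡.sym (#∁≡q∸n⇒#≡n (agree? f△ g△) 4≤q (proj₂ adjacent)))

      adjacent⇒slopes-differ : ¬ coef σ ≈ coef π
      adjacent⇒slopes-differ a≈b = ℕ.<⇒≱ 3<#agree△ (#agree△≤3-if-disjoint λ _ πx≈σx →
        proj₁ adjacent (same-slope-Agree⇒≈AGL π σ (sym a≈b) πx≈σx))

      adjacent⇒moves-F : ¬ ⟦ K ⟧ π F ≈ F
      adjacent⇒moves-F = f[F]≉F (Agree-unique π σ adjacent⇒slopes-differ) 3<#agree△

      adjacent⇒collision : ⟦ K ⟧ π F ≈ ⟦ K ⟧ σ (preimage π F)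
      adjacent⇒collision = f[F]≈g[u] (Agree-unique π σ adjacent⇒slopes-differ) 3<#agree△ (⟦⟧-preimage π F)

      adjacent⇒hd△≡hd∸3 : hd K (contract K F (⟦ K ⟧ π)) (contract K F (⟦ K ⟧ σ)) ≡ hd K (⟦ K ⟧ π) (⟦ K ⟧ σ) ∸ 3
      adjacent⇒hd△≡hd∸3 = ≡.trans (proj₂ adjacent)
        (≡.trans (≡.sym (ℕ.∸-+-assoc q 1 3)) (≡.cong (_∸ 3) (≡.sym (hd-⟦⟧ π σ adjacent⇒slopes-differ))))

      preimage≉F : ¬ preimage π F - F ≈ 0#
      preimage≉F u-F≈0 = adjacent⇒moves-F (trans (⟦⟧-cong π (sym (x-y≈0⇒x≈y _ _ u-F≈0))) (⟦⟧-preimage π F))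

    adjacent⇒a²+ab+b²≈0 : ∀ π σ → Adjacent K F π σ →
                           coef σ * coef σ + coef σ * coef π + coef π * coef π ≈ 0#
    adjacent⇒a²+ab+b²≈0 π σ adjacent = slope-relations⇒a²+ab+b²≈0
      (preimage≉F π σ adjacent) (preimage≉F σ π adjacent′)
      (⟦⟧-collision π σ (⟦⟧-preimage π F) (⟦⟧-preimage σ F) (adjacent⇒collision π σ adjacent))
      (⟦⟧-collision σ π (⟦⟧-preimage σ F) (⟦⟧-preimage π F) (adjacent⇒collision σ π adjacent′))
      where adjacent′ = Adjacent-sym F π σ adjacent

  module _ (F : Carrier) where

    Fixes : Pred (Fin q × Fin q) ℓ
    Fixes p = ¬ enum (proj₁ p) ≈ 0# × enum (proj₁ p) * F + enum (proj₂ p) ≈ F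

    fixes? : Decidable Fixes
    fixes? p = ¬? (enum (proj₁ p) ≟ 0#) ×-dec ((enum (proj₁ p) * F + enum (proj₂ p)) ≟ F)

    nonzero? : Decidable (λ i → ¬ enum i ≈ 0#)
    nonzero? = ∁? (_≟ 0#) ∘ enum

    #fixes-row : ∀ i → Dec (enum i ≈ 0#) → count fixes? (tabulate (i ,_)) ≡ count nonzero? [ i ]
    #fixes-row i (yes aᵢ≈0) = ≡.trans (count-tabulate≡0 fixes? (i ,_) (λ _ fixes → proj₁ fixes aᵢ≈0))
                                      (≡.cong length (≡.sym (filter-reject nonzero? (λ aᵢ≉0 → aᵢ≉0 aᵢ≈0))))
    #fixes-row i (no aᵢ≉0) = ≡.trans
      (ℕ.≤-antisym (count-tabulate≤1 fixes? (i ,_) unique) (count-tabulate≥1 fixes? (i ,_) j₀ fixes-j₀))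
      (≡.cong length (≡.sym (filter-accept nonzero? aᵢ≉0)))
      where
      unique : ∀ j k → Fixes (i , j) → Fixes (i , k) → j ≡ k
      unique j k (_ , fixesⱼ) (_ , fixesₖ) =
        enum-inj j k (∙-cancelˡ (enum i * F) (enum j) (enum k) (trans fixesⱼ (sym fixesₖ)))
      j₀ = proj₁ (enum-sur (F - enum i * F))
      fixes-j₀ : Fixes (i , j₀)
      fixes-j₀ = aᵢ≉0 , trans (+-congˡ (proj₂ (enum-sur (F - enum i * F))))
                              (solve 2 (λ a F → a :* F :+ (F :- a :* F) := F) refl (enum i) F)

    #fixing≡q∸1 : #fixing K F ≡ q ∸ 1
    #fixing≡q∸1 = ≡.trans
      (count-cartesianProduct fixes? nonzero? (allFin q)
        (λ i → ≡.trans (≡.cong (count fixes?) (map-tabulate id (i ,_))) (#fixes-row i (enum i ≟ 0#))) (allFin q))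
      (#∁≡q∸1 (_≟ 0#) (λ x≈y x≈0 → trans (sym x≈y) x≈0) (λ x≈0 y≈0 → trans x≈0 (sym y≈0)) refl)

  -- The only use of q ≡ 1 (mod 3): it excludes q = 2, 3, where q ∸ 4 truncates to 0.
  4≤q : q % 3 ≡ 1 → 4 ≤ q
  4≤q = 2≤n∧n%3≡1⇒4≤n q (i≢j⇒2≤n i₀≢i₁)
    where
    i₀≢i₁ : proj₁ (enum-sur 0#) ≢ proj₁ (enum-sur 1#)
    i₀≢i₁ i₀≡i₁ = 0≉1 (trans (sym (proj₂ (enum-sur 0#))) (trans (reflexive (≡.cong enum i₀≡i₁)) (proj₂ (enum-sur 1#))))

lemma4 : {c ℓ : Level} (q : ℕ) (K : FiniteField c ℓ q) → q % 3 ≡ 1 →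
  let open FiniteField K in
  (F : Carrier) →
  ((π σ : AGL K) → ¬ (AGL.coef σ ≈ AGL.coef π) → hd K (⟦ K ⟧ π) (⟦ K ⟧ σ) ≡ q ∸ 1)
  × (((π : AGL K) → ⟦ K ⟧ π F ≈ F → (σ : AGL K) → ¬ Adjacent K F π σ)
     × #fixing K F ≡ q ∸ 1)
  × ((π σ : AGL K) → Adjacent K F π σ →
      let a = AGL.coef σ
          b = AGL.coef π
          r₁ = a * (b ⁻¹)
          r₂ = b * (a ⁻¹)
      in ((hd K (⟦ K ⟧ π) (⟦ K ⟧ σ) ≡ q ∸ 1)
          × (hd K (contract K F (⟦ K ⟧ π)) (contract K F (⟦ K ⟧ σ)) ≡ hd K (⟦ K ⟧ π) (⟦ K ⟧ σ) ∸ 3))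
         × ((r₁ * r₁ + r₁ + 1#) ≈ 0#) × ((r₂ * r₂ + r₂ + 1#) ≈ 0#) × ¬ (r₁ ≈ r₂))
lemma4 q K q%3≡1 F =
  hd-⟦⟧ ,
  ((λ π πF≈F σ adjacent → adjacent⇒moves-F π σ adjacent πF≈F) , #fixing≡q∸1 F) ,
  λ π σ adjacent →
    let a≉b = adjacent⇒slopes-differ π σ adjacent
        a²+ab+b²≈0 = adjacent⇒a²+ab+b²≈0 π σ adjacent
    in (hd-⟦⟧ π σ a≉b , adjacent⇒hd△≡hd∸3 π σ adjacent)
       , a²+ab+b²≈0⇒root (coef≉0 π) a²+ab+b²≈0
       , a²+ab+b²≈0⇒root (coef≉0 σ) (a²+ab+b²≈0-sym a²+ab+b²≈0)
       , a²+ab+b²≈0⇒ratios-distinct (coef≉0 σ) (coef≉0 π) a≉b a²+ab+b²≈0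
  where
  open FiniteField K
  open FieldProperties K
  open ContractionGraph K
  open Adjacency (4≤q q%3≡1) F
  open AGL
  open import Data.Product using (_,_)
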